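{- Let $T$ be a rooted tree. For every increasing coloring $f\colon V(T)\to\mathbb{Z}^+$ there exists a unique multiset $S$ of vertices of $T$ such that $f=f_S$.
   Context: $T$ is a finite rooted tree with root $v_T$. The coheight $h_v$ of a vertex $v$ is the length of the path from $v_T$ to $v$. $S_g$ denotes the subtree consisting of $g$ and all its descendants. A coloring $f\colon V(T)\to\mathbb{Z}^+$ is increasing if $f(u)<f(v)$ whenever $u$ is the parent of $v$. For a multiset $S$ of vertices, $f_S$ is the coloring $f_S(v)=1+h_v+\sum_{g\in S}\mathbb{1}_{V(S_g)}(v)$, the sum counted with multiplicity (i.e. $f_S(v)-1-h_v$ is the number of elements of $S$, with multiplicity, that are ancestors of $v$ or equal to $v$). -}

module Defs where

open import Data.Nat using (ℕ; zero; suc; _+_; _*_; _<_; _≤_)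
open import Data.Fin using (Fin; zero; suc)
open import Data.Bool using (Bool; true; false; if_then_else_)
open import Data.Vec using (tabulate)
open import Data.Vec using () renaming (sum to vsum)

-- A finite rooted tree with vertex set Fin (suc n), built by successively
-- attaching new leaves.  Every finite rooted tree arises this way (up to
-- relabelling of vertices).
--   root      : the one-vertex tree; its only vertex (zero) is the root.
--   add t p   : attach a new leaf (vertex zero) below the vertex p of t;
--               the old vertices v of t become suc v.
data Tree : ℕ → Set where
  root : Tree zero
  add  : ∀ {n} → Tree n → Fin (suc n) → Tree (suc n)

Multiset : ∀ {n} → Tree n → Set
Multiset {n} _ = Fin (suc n) → ℕ

data Parent : ∀ {n} → Tree n → Fin (suc n) → Fin (suc n) → Set where
  new : ∀ {n} {t : Tree n} {p} → Parent (add t p) (suc p) zero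
  old : ∀ {n} {t : Tree n} {p u v} → Parent t u v → Parent (add t p) (suc u) (suc v)

coheight : ∀ {n} → Tree n → Fin (suc n) → ℕ
coheight root zero = zero
coheight (add t p) zero = suc (coheight t p)
coheight (add t p) (suc v) = coheight t v

-- inSub t g v = true iff v ∈ V(S_g), i.e. v is g or a descendant of g
inSub : ∀ {n} → Tree n → Fin (suc n) → Fin (suc n) → Bool
inSub root zero zero = true
inSub (add t p) zero zero = true
inSub (add t p) zero (suc v) = false
inSub (add t p) (suc g) zero = inSub t g p
inSub (add t p) (suc g) (suc v) = inSub t g v

indicator : Bool → ℕ
indicator b = if b then 1 else 0

fS : ∀ {n} (t : Tree n) → Multiset t → Fin (suc n) → ℕ
fS {n} t S v = 1 + coheight t v + vsum (tabulate {n = suc n} (λ g → S g * indicator (inSub t g v)))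

Positive : ∀ {n} → (Fin (suc n) → ℕ) → Set
Positive f = ∀ v → 1 ≤ f v

Increasing : ∀ {n} → Tree n → (Fin (suc n) → ℕ) → Set
Increasing t f = ∀ u v → Parent t u v → f u < f v

-- A new leaf below p lies
-- in S_g exactly when g is the leaf or p lies in S_g, and its coheight exceeds
-- that of p by one, so f_S(leaf) = S(leaf) + 1 + f_S(p), while f_S on the old
-- vertices ignores S(leaf).
-- Hence S(leaf) is forced to be f(leaf) - f(p) - 1, which is a natural number
-- precisely because f is increasing; on the root, S(root) = f(root) - 1 ≥ 0.
module Submission where

open import Defs
open import Data.Nat using (ℕ; suc; zero; _+_; _∸_)
open import Data.Nat.Properties
  using (suc-injective; +-identityʳ; *-identityʳ; *-zeroʳ; +-cancelʳ-≡; m+[n∸m]≡n; m∸n+n≡m)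
open import Data.Nat.Tactic.RingSolver using (solve-∀)
open import Data.Fin using (Fin; zero; suc)
open import Data.Product using (Σ; ∃; _×_; _,_)
open import Function using (_∘_)
open import Relation.Binary.PropositionalEquality
  using (_≡_; _≗_; refl; sym; trans; cong; module ≡-Reasoning)

fS-root : (S : Multiset root) → fS root S zero ≡ suc (S zero)
fS-root S = cong suc (trans (+-identityʳ _) (*-identityʳ (S zero)))

fS-add-old : ∀ {n} (t : Tree n) p (S : Multiset (add t p)) v →
  fS (add t p) S (suc v) ≡ fS t (S ∘ suc) v
fS-add-old t p S v rewrite *-zeroʳ (S zero) = refl

fS-add-new : ∀ {n} (t : Tree n) p (S : Multiset (add t p)) →
  fS (add t p) S zero ≡ S zero + suc (fS t (S ∘ suc) p)
fS-add-new t p S rewrite *-identityʳ (S zero) = shift (S zero) (coheight t p) _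
  where
  shift : ∀ a h r → suc (suc (h + (a + r))) ≡ a + suc (suc (h + r))
  shift = solve-∀

fS-injective : ∀ {n} (t : Tree n) {S S′ : Multiset t} → fS t S ≗ fS t S′ → S ≗ S′
fS-injective root {S} {S′} eq zero = suc-injective (trans (sym (fS-root S)) (trans (eq zero) (fS-root S′)))
fS-injective (add t p) {S} {S′} eq (suc g) =
  fS-injective t {S ∘ suc} {S′ ∘ suc} (λ v → trans (sym (fS-add-old t p S v)) (trans (eq (suc v)) (fS-add-old t p S′ v))) g
fS-injective (add t p) {S} {S′} eq zero =
  +-cancelʳ-≡ _ (S zero) (S′ zero) (begin
    S zero + suc (fS t (S ∘ suc) p)   ≡⟨ sym (fS-add-new t p S) ⟩
    fS (add t p) S zero               ≡⟨ eq zero ⟩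
    fS (add t p) S′ zero              ≡⟨ fS-add-new t p S′ ⟩
    S′ zero + suc (fS t (S′ ∘ suc) p) ≡⟨ cong (λ x → S′ zero + suc x) parents ⟩
    S′ zero + suc (fS t (S ∘ suc) p)  ∎)
  where
  open ≡-Reasoning
  parents : fS t (S′ ∘ suc) p ≡ fS t (S ∘ suc) p
  parents = trans (sym (fS-add-old t p S′ p)) (trans (sym (eq (suc p))) (fS-add-old t p S p))

increasing-old : ∀ {n} {t : Tree n} {p} {f : Fin (suc (suc n)) → ℕ} →
  Increasing (add t p) f → Increasing t (f ∘ suc)
increasing-old inc u v uv = inc (suc u) (suc v) (old uv)

fS-surjective : ∀ {n} (t : Tree n) (f : Fin (suc n) → ℕ) → Positive {n} f → Increasing t f →
  ∃ λ (S : Multiset t) → f ≗ fS t S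
fS-surjective root f pos inc = S , f≗fS
  where
  S : Multiset root
  S zero = f zero ∸ 1
  f≗fS : f ≗ fS root S
  f≗fS zero = trans (sym (m+[n∸m]≡n (pos zero))) (sym (fS-root S))
fS-surjective (add t p) f pos inc with fS-surjective t (f ∘ suc) (pos ∘ suc) (increasing-old inc)
... | S₀ , f≗fS₀ = S , f≗fS
  where
  S : Multiset (add t p)
  S zero    = f zero ∸ suc (f (suc p))
  S (suc g) = S₀ g
  f≗fS : f ≗ fS (add t p) S
  f≗fS (suc v) = trans (f≗fS₀ v) (sym (fS-add-old t p S v))
  f≗fS zero = begin
    f zero                          ≡⟨ sym (m∸n+n≡m (inc (suc p) zero new)) ⟩
    S zero + suc (f (suc p))        ≡⟨ cong (λ x → S zero + suc x) (f≗fS₀ p) ⟩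
    S zero + suc (fS t S₀ p)        ≡⟨ sym (fS-add-new t p S) ⟩
    fS (add t p) S zero             ∎
    where open ≡-Reasoning

theorem4p2 : ∀ {n} (t : Tree n) (f : Fin (suc n) → ℕ) → Positive {n} f → Increasing t f →
    Σ (Multiset t) (λ S → (∀ v → f v ≡ fS t S v) ×
      (∀ (S′ : Multiset t) → (∀ v → f v ≡ fS t S′ v) → ∀ g → S′ g ≡ S g))
theorem4p2 t f pos inc with fS-surjective t f pos inc
... | S , f≗fS = S , f≗fS , λ S′ f≗fS′ → fS-injective t (λ v → trans (sym (f≗fS′ v)) (f≗fS v))
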